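{- For every cyclic sentence $W$ in the letters $\{A,X,B\}$ containing no letter $X$, one has $|W|=|\overline W|$, where $\overline W$ is the reversed cyclic sentence.
   Context: A cyclic sentence of length $N$ is a string of length $N$ in the letters $A,X,B$ considered up to cyclic permutation. Words with (coefficient, weight): $X$ $(1,0)$; $XA$ $(1,1)$; $XAA$ $(1,1)$; $XBA$ $(1,1)$; $AXA$ $(2,1)$; $AAA$ $(-1,1)$; $BA$ $(-1,1)$; $ABA$ $(-1,1)$; $XXA$ $(-2,1)$. A parsing of a cyclic sentence is a decomposition of the cyclic string into consecutive blocks each equal to one of these words; its coefficient is the product and its weight the sum of those of its words. With $c(S,w)$ the sum of coefficients of parsings of weight $w$, $|S|=\sum_{w\ge0}c(S,w)t^w$. -}

module Defs where

open import Data.Bool using (Bool; true; false)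
open import Data.Nat using (ℕ; zero; suc)
import Data.Nat as ℕ
open import Data.Integer using (ℤ; +_; -[1+_])
import Data.Integer as ℤ
open import Data.List using (List; []; _∷_; _++_; zip; foldr; map)
open import Data.Maybe using (Maybe; just; nothing)
open import Data.Product using (_×_; _,_)
open import Relation.Nullary using (yes; no)

data Letter : Set where
  A X B : Letter

-- The dictionary: a block (list of letters) is a word iff wordData returns
-- just (coefficient , weight).
wordData : List Letter → Maybe (ℤ × ℕ)
wordData (X ∷ [])           = just (+ 1 , 0)
wordData (X ∷ A ∷ [])       = just (+ 1 , 1)
wordData (X ∷ A ∷ A ∷ [])   = just (+ 1 , 1)
wordData (X ∷ B ∷ A ∷ [])   = just (+ 1 , 1)
wordData (A ∷ X ∷ A ∷ [])   = just (+ 2 , 1)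
wordData (A ∷ A ∷ A ∷ [])   = just (-[1+ 0 ] , 1)
wordData (B ∷ A ∷ [])       = just (-[1+ 0 ] , 1)
wordData (A ∷ B ∷ A ∷ [])   = just (-[1+ 0 ] , 1)
wordData (X ∷ X ∷ A ∷ [])   = just (-[1+ 1 ] , 1)
wordData _                  = nothing

-- A cyclic sentence of length N is represented by a string (List Letter) of
-- length N; a choice of cut positions is a List Bool of the same length
-- (true at position i = a block starts at position i).
-- splitAtCuts returns (letters before the first cut , blocks starting at cuts).
splitAtCuts : List (Letter × Bool) → List Letter × List (List Letter)
splitAtCuts [] = [] , []
splitAtCuts ((a , true) ∷ r) with splitAtCuts r
... | l , bs = [] , (a ∷ l) ∷ bs
splitAtCuts ((a , false) ∷ r) with splitAtCuts r
... | l , bs = a ∷ l , bs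

-- the last block wraps around the end of the string to the start
appendLast : List (List Letter) → List Letter → List (List Letter)
appendLast [] l = []
appendLast (b ∷ []) l = (b ++ l) ∷ []
appendLast (b ∷ b' ∷ bs) l = b ∷ appendLast (b' ∷ bs) l

cyclicBlocks : List Letter → List Bool → Maybe (List (List Letter))
cyclicBlocks s cs with splitAtCuts (zip s cs)
... | l , [] = nothing
... | l , (b ∷ bs) = just (appendLast (b ∷ bs) l)

parseValue : List (List Letter) → Maybe (ℤ × ℕ)
parseValue [] = just (+ 1 , 0)
parseValue (b ∷ bs) with wordData b | parseValue bs
... | just (c , w) | just (c' , w') = just (c ℤ.* c' , w ℕ.+ w')
... | _ | _ = nothing

cutSets : ℕ → List (List Bool)
cutSets zero = [] ∷ []
cutSets (suc n) = map (true ∷_) (cutSets n) ++ map (false ∷_) (cutSets n)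

contrib : List Letter → ℕ → List Bool → ℤ
contrib s w cs with cyclicBlocks s cs
... | nothing = + 0
... | just bs with parseValue bs
...   | nothing = + 0
...   | just (c , w') with w' ℕ.≟ w
...     | yes _ = c
...     | no _ = + 0

-- c(S,w): sum of coefficients of parsings of S of weight w;
-- |S| = Σ_w c(S,w) t^w is identified with its coefficient function.
coeff : List Letter → ℕ → ℤ
coeff s w = foldr (λ cs acc → contrib s w cs ℤ.+ acc) (+ 0) (cutSets (Data.List.length s))

module Submission where

-- Without the letter X only three words of the dictionary can occur, namely
-- BA, AAA and ABA, each with coefficient −1 and weight 1; they form a prefix
-- code, so a linear string has at most one tiling by them and a tiling with k
-- blocks contributes (−1)^k t^k.

open import Defs
open import Data.Nat using (ℕ)
open import Data.List using (List; reverse)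
open import Data.List.Membership.Propositional using (_∉_)
open import Relation.Binary.PropositionalEquality using (_≡_)

open import Data.Bool using (Bool; true; false)
open import Data.Nat as ℕ using (zero; suc)
import Data.Nat.Properties as ℕP
open import Data.Integer as ℤ using (ℤ; 0ℤ; 1ℤ; -1ℤ)
import Data.Integer.Properties as ℤP
open import Algebra.Properties.CommutativeSemigroup ℤP.+-commutativeSemigroup
  using (interchange)
open import Data.List using ([]; _∷_; _++_; zip; foldr; map; length; replicate)
import Data.List.Properties as LP
open import Data.List.Relation.Unary.All as All using (All; []; _∷_)
import Data.List.Relation.Unary.All.Properties as AllP
open import Data.List.Relation.Unary.Any using (here; there)
open import Data.Maybe as M using (Maybe; just; nothing; _<∣>_)
open import Data.Product using (_×_; _,_; proj₁; proj₂; Σ)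
open import Data.Sum using (_⊎_; inj₁; inj₂)
open import Data.Empty using (⊥-elim)
open import Relation.Binary.PropositionalEquality
  using (refl; sym; trans; cong; cong₂; subst; module ≡-Reasoning)
open import Relation.Nullary using (yes; no)

open ≡-Reasoning

sumOver : (List Bool → ℤ) → List (List Bool) → ℤ
sumOver F = foldr (λ cs acc → F cs ℤ.+ acc) 0ℤ

ΣCuts : ℕ → (List Bool → ℤ) → ℤ
ΣCuts n F = sumOver F (cutSets n)

sumOver-++ : ∀ F xs ys → sumOver F (xs ++ ys) ≡ sumOver F xs ℤ.+ sumOver F ys
sumOver-++ F []       ys = sym (ℤP.+-identityˡ _)
sumOver-++ F (x ∷ xs) ys =
  trans (cong (λ t → F x ℤ.+ t) (sumOver-++ F xs ys)) (sym (ℤP.+-assoc (F x) _ _))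

sumOver-map : ∀ F g xs → sumOver F (map g xs) ≡ sumOver (λ c → F (g c)) xs
sumOver-map F g []       = refl
sumOver-map F g (x ∷ xs) = cong (λ t → F (g x) ℤ.+ t) (sumOver-map F g xs)

sumOver-zero : ∀ xs → sumOver (λ _ → 0ℤ) xs ≡ 0ℤ
sumOver-zero []       = refl
sumOver-zero (x ∷ xs) = trans (ℤP.+-identityˡ _) (sumOver-zero xs)

sumOver-scale : ∀ k F xs → sumOver (λ c → k ℤ.* F c) xs ≡ k ℤ.* sumOver F xs
sumOver-scale k F []       = sym (ℤP.*-zeroʳ k)
sumOver-scale k F (x ∷ xs) =
  trans (cong (λ t → k ℤ.* F x ℤ.+ t) (sumOver-scale k F xs)) (sym (ℤP.*-distribˡ-+ k (F x) _))

ΣCuts-first : ∀ n F →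
  ΣCuts (suc n) F ≡ ΣCuts n (λ c → F (true ∷ c)) ℤ.+ ΣCuts n (λ c → F (false ∷ c))
ΣCuts-first n F =
  trans (sumOver-++ F (map (true ∷_) (cutSets n)) (map (false ∷_) (cutSets n)))
        (cong₂ ℤ._+_ (sumOver-map F (true ∷_) (cutSets n)) (sumOver-map F (false ∷_) (cutSets n)))

ΣCuts-cong : ∀ n F G → (∀ cs → length cs ≡ n → F cs ≡ G cs) → ΣCuts n F ≡ ΣCuts n G
ΣCuts-cong zero    F G F≗G = cong (ℤ._+ 0ℤ) (F≗G [] refl)
ΣCuts-cong (suc n) F G F≗G = begin
  ΣCuts (suc n) F
    ≡⟨ ΣCuts-first n F ⟩
  ΣCuts n (λ c → F (true ∷ c)) ℤ.+ ΣCuts n (λ c → F (false ∷ c))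
    ≡⟨ cong₂ ℤ._+_ (ΣCuts-cong n _ _ (λ cs e → F≗G (true ∷ cs) (cong suc e)))
                   (ΣCuts-cong n _ _ (λ cs e → F≗G (false ∷ cs) (cong suc e))) ⟩
  ΣCuts n (λ c → G (true ∷ c)) ℤ.+ ΣCuts n (λ c → G (false ∷ c))
    ≡⟨ sym (ΣCuts-first n G) ⟩
  ΣCuts (suc n) G ∎

ΣCuts-zero : ∀ n F → (∀ cs → length cs ≡ n → F cs ≡ 0ℤ) → ΣCuts n F ≡ 0ℤ
ΣCuts-zero n F F≗0 = trans (ΣCuts-cong n F (λ _ → 0ℤ) F≗0) (sumOver-zero (cutSets n))

-- Splitting off the last cut bit (needed to move a letter from the front to the back).
ΣCuts-last : ∀ n F →
  ΣCuts (suc n) F ≡ ΣCuts n (λ c → F (c ++ true ∷ [])) ℤ.+ ΣCuts n (λ c → F (c ++ false ∷ []))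
ΣCuts-last zero F = cong (ℤ._+ (F (false ∷ []) ℤ.+ 0ℤ)) (sym (ℤP.+-identityʳ (F (true ∷ []))))
ΣCuts-last (suc n) F = begin
  ΣCuts (suc (suc n)) F
    ≡⟨ ΣCuts-first (suc n) F ⟩
  ΣCuts (suc n) (λ c → F (true ∷ c)) ℤ.+ ΣCuts (suc n) (λ c → F (false ∷ c))
    ≡⟨ cong₂ ℤ._+_ (ΣCuts-last n (λ c → F (true ∷ c))) (ΣCuts-last n (λ c → F (false ∷ c))) ⟩
  (tt ℤ.+ tf) ℤ.+ (ft ℤ.+ ff)
    ≡⟨ interchange tt tf ft ff ⟩
  (tt ℤ.+ ft) ℤ.+ (tf ℤ.+ ff)
    ≡⟨ sym (cong₂ ℤ._+_ (ΣCuts-first n (λ c → F (c ++ true ∷ [])))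
                        (ΣCuts-first n (λ c → F (c ++ false ∷ [])))) ⟩
  ΣCuts (suc n) (λ c → F (c ++ true ∷ [])) ℤ.+ ΣCuts (suc n) (λ c → F (c ++ false ∷ [])) ∎
  where
  tt = ΣCuts n (λ c → F (true ∷ c ++ true ∷ []))
  tf = ΣCuts n (λ c → F (true ∷ c ++ false ∷ []))
  ft = ΣCuts n (λ c → F (false ∷ c ++ true ∷ []))
  ff = ΣCuts n (λ c → F (false ∷ c ++ false ∷ []))

-- Generating functions are represented by their coefficient functions ℕ → ℤ;
-- negT f is the series −t·f, the contribution of one block BA, AAA or ABA.

negT : (ℕ → ℤ) → ℕ → ℤ
negT f zero    = 0ℤ
negT f (suc w) = -1ℤ ℤ.* f w

negT-cong : ∀ f g → (∀ v → f v ≡ g v) → ∀ w → negT f w ≡ negT g w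
negT-cong f g f≗g zero    = refl
negT-cong f g f≗g (suc w) = cong (-1ℤ ℤ.*_) (f≗g w)

ΣCuts-negT : ∀ n (H : List Bool → ℕ → ℤ) w →
  ΣCuts n (λ c → negT (H c) w) ≡ negT (λ v → ΣCuts n (λ c → H c v)) w
ΣCuts-negT n H zero    = sumOver-zero (cutSets n)
ΣCuts-negT n H (suc w) = sumOver-scale -1ℤ (λ c → H c w) (cutSets n)

-- Values (coefficient , weight) of parsings form a commutative monoid with
-- absorbing element nothing ("not a parsing"); parseValue is its product.

Value : Set
Value = Maybe (ℤ × ℕ)

infixl 7 _⊗_
_⊗_ : Value → Value → Value
just (c , w) ⊗ just (c' , w') = just (c ℤ.* c' , w ℕ.+ w')
_            ⊗ _              = nothing

unit : Value
unit = just (1ℤ , 0)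

⊗-comm : ∀ a b → a ⊗ b ≡ b ⊗ a
⊗-comm (just (c , w)) (just (c' , w')) =
  cong₂ (λ x y → just (x , y)) (ℤP.*-comm c c') (ℕP.+-comm w w')
⊗-comm (just _) nothing  = refl
⊗-comm nothing  (just _) = refl
⊗-comm nothing  nothing  = refl

⊗-assoc : ∀ a b c → a ⊗ b ⊗ c ≡ a ⊗ (b ⊗ c)
⊗-assoc (just (a , x)) (just (b , y)) (just (c , z)) =
  cong₂ (λ p q → just (p , q)) (ℤP.*-assoc a b c) (ℕP.+-assoc x y z)
⊗-assoc nothing  b        c       = refl
⊗-assoc (just _) nothing  c       = refl
⊗-assoc (just _) (just _) nothing = refl

⊗-identityˡ : ∀ a → unit ⊗ a ≡ a
⊗-identityˡ (just (c , w)) = cong (λ p → just (p , w)) (ℤP.*-identityˡ c)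
⊗-identityˡ nothing        = refl

⊗-identityʳ : ∀ a → a ⊗ unit ≡ a
⊗-identityʳ a = trans (⊗-comm a unit) (⊗-identityˡ a)

⊗-zeroʳ : ∀ a → a ⊗ nothing ≡ nothing
⊗-zeroʳ (just _) = refl
⊗-zeroʳ nothing  = refl

parseValue-∷ : ∀ b bs → parseValue (b ∷ bs) ≡ wordData b ⊗ parseValue bs
parseValue-∷ b bs with wordData b | parseValue bs
... | just (c , w) | just (c' , w') = refl
... | just _       | nothing        = refl
... | nothing      | _              = refl

parseValue-++ : ∀ xs ys → parseValue (xs ++ ys) ≡ parseValue xs ⊗ parseValue ys
parseValue-++ []       ys = sym (⊗-identityˡ _)
parseValue-++ (x ∷ xs) ys = begin
  parseValue (x ∷ xs ++ ys)                      ≡⟨ parseValue-∷ x (xs ++ ys) ⟩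
  wordData x ⊗ parseValue (xs ++ ys)             ≡⟨ cong (wordData x ⊗_) (parseValue-++ xs ys) ⟩
  wordData x ⊗ (parseValue xs ⊗ parseValue ys)   ≡⟨ sym (⊗-assoc (wordData x) _ _) ⟩
  wordData x ⊗ parseValue xs ⊗ parseValue ys     ≡⟨ cong (_⊗ parseValue ys) (sym (parseValue-∷ x xs)) ⟩
  parseValue (x ∷ xs) ⊗ parseValue ys            ∎

parseValue-rotate : ∀ b bs → parseValue (b ∷ bs) ≡ parseValue (bs ++ b ∷ [])
parseValue-rotate b bs = begin
  parseValue (b ∷ bs)                   ≡⟨ parseValue-∷ b bs ⟩
  wordData b ⊗ parseValue bs            ≡⟨ ⊗-comm (wordData b) (parseValue bs) ⟩
  parseValue bs ⊗ wordData b            ≡⟨ cong (parseValue bs ⊗_) (sym (⊗-identityʳ (wordData b))) ⟩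
  parseValue bs ⊗ (wordData b ⊗ unit)   ≡⟨ cong (parseValue bs ⊗_) (sym (parseValue-∷ b [])) ⟩
  parseValue bs ⊗ parseValue (b ∷ [])   ≡⟨ sym (parseValue-++ bs (b ∷ [])) ⟩
  parseValue (bs ++ b ∷ [])             ∎

valueAt : Value → ℕ → ℤ
valueAt nothing        w = 0ℤ
valueAt (just (c , k)) w with k ℕ.≟ w
... | yes _ = c
... | no  _ = 0ℤ

valueAt-negT : ∀ v w → valueAt (just (-1ℤ , 1) ⊗ v) w ≡ negT (valueAt v) w
valueAt-negT nothing        zero    = refl
valueAt-negT nothing        (suc w) = sym (ℤP.*-zeroʳ -1ℤ)
valueAt-negT (just (c , k)) zero    = refl
valueAt-negT (just (c , k)) (suc w) with k ℕ.≟ w | suc k ℕ.≟ suc w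
... | yes _   | yes _   = refl
... | no  _   | no  _   = sym (ℤP.*-zeroʳ -1ℤ)
... | yes k≡w | no  k≢w = ⊥-elim (k≢w (cong suc k≡w))
... | no  k≢w | yes k≡w = ⊥-elim (k≢w (ℕP.suc-injective k≡w))

valueAt-dead : ∀ b bs w → wordData b ≡ nothing → valueAt (parseValue (b ∷ bs)) w ≡ 0ℤ
valueAt-dead b bs w dead rewrite parseValue-∷ b bs | dead = refl

valueAt-negWord : ∀ b bs w → wordData b ≡ just (-1ℤ , 1) →
  valueAt (parseValue (b ∷ bs)) w ≡ negT (valueAt (parseValue bs)) w
valueAt-negWord b bs w neg rewrite parseValue-∷ b bs | neg = valueAt-negT (parseValue bs) w

close : List Letter × List (List Letter) → Maybe (List (List Letter))
close (l , [])     = nothing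
close (l , b ∷ bs) = just (appendLast (b ∷ bs) l)

blocksAt : Maybe (List (List Letter)) → ℕ → ℤ
blocksAt nothing   w = 0ℤ
blocksAt (just bs) w = valueAt (parseValue bs) w

contrib-close : ∀ s w cs → contrib s w cs ≡ blocksAt (close (splitAtCuts (zip s cs))) w
contrib-close s w cs with splitAtCuts (zip s cs)
... | l , []     = refl
... | l , b ∷ bs with parseValue (appendLast (b ∷ bs) l)
...   | nothing       = refl
...   | just (c , w') with w' ℕ.≟ w
...     | yes _ = refl
...     | no  _ = refl

-- Moving the first letter (with its cut bit) to the end
-- changes the linear split in a controlled way: a cut there adds a new
-- singleton block, no cut extends the last block (or the leading letters).

splitAtCuts-∷ʳ-cut : ∀ z a →
  splitAtCuts (z ++ (a , true) ∷ []) ≡ (proj₁ (splitAtCuts z) , proj₂ (splitAtCuts z) ++ (a ∷ []) ∷ [])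
splitAtCuts-∷ʳ-cut []              a = refl
splitAtCuts-∷ʳ-cut ((x , true) ∷ z)  a rewrite splitAtCuts-∷ʳ-cut z a = refl
splitAtCuts-∷ʳ-cut ((x , false) ∷ z) a rewrite splitAtCuts-∷ʳ-cut z a = refl

extendLast : List Letter × List (List Letter) → Letter → List Letter × List (List Letter)
extendLast (l , [])     a = (l ++ a ∷ [] , [])
extendLast (l , b ∷ bs) a = (l , appendLast (b ∷ bs) (a ∷ []))

splitAtCuts-∷ʳ-noCut : ∀ z a → splitAtCuts (z ++ (a , false) ∷ []) ≡ extendLast (splitAtCuts z) a
splitAtCuts-∷ʳ-noCut [] a = refl
splitAtCuts-∷ʳ-noCut ((x , true) ∷ z) a rewrite splitAtCuts-∷ʳ-noCut z a = newBlock (splitAtCuts z)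
  where
  newBlock : ∀ p → ([] , (x ∷ proj₁ (extendLast p a)) ∷ proj₂ (extendLast p a))
                 ≡ extendLast ([] , (x ∷ proj₁ p) ∷ proj₂ p) a
  newBlock (l , [])    = refl
  newBlock (l , _ ∷ _) = refl
splitAtCuts-∷ʳ-noCut ((x , false) ∷ z) a rewrite splitAtCuts-∷ʳ-noCut z a = leading (splitAtCuts z)
  where
  leading : ∀ p → (x ∷ proj₁ (extendLast p a) , proj₂ (extendLast p a))
                ≡ extendLast (x ∷ proj₁ p , proj₂ p) a
  leading (l , [])    = refl
  leading (l , _ ∷ _) = refl

appendLast-[] : ∀ bs → appendLast bs [] ≡ bs
appendLast-[] []            = refl
appendLast-[] (b ∷ [])      = cong (_∷ []) (LP.++-identityʳ b)
appendLast-[] (b ∷ b' ∷ bs) = cong (b ∷_) (appendLast-[] (b' ∷ bs))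

appendLast-∷ʳ : ∀ bs x l → appendLast (bs ++ x ∷ []) l ≡ bs ++ (x ++ l) ∷ []
appendLast-∷ʳ []            x l = refl
appendLast-∷ʳ (b ∷ [])      x l = refl
appendLast-∷ʳ (b ∷ b' ∷ bs) x l = cong (b ∷_) (appendLast-∷ʳ (b' ∷ bs) x l)

appendLast-++ : ∀ b bs x y → appendLast (appendLast (b ∷ bs) x) y ≡ appendLast (b ∷ bs) (x ++ y)
appendLast-++ b []              x y = cong (_∷ []) (LP.++-assoc b x y)
appendLast-++ b (b' ∷ [])       x y = cong (b ∷_) (appendLast-++ b' [] x y)
appendLast-++ b (b' ∷ b'' ∷ bs) x y = cong (b ∷_) (appendLast-++ b' (b'' ∷ bs) x y)

close-appendLast : ∀ l c cs x → close (l , appendLast (c ∷ cs) x) ≡ just (appendLast (appendLast (c ∷ cs) x) l)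
close-appendLast l c []      x = refl
close-appendLast l c (_ ∷ _) x = refl

zip-∷ʳ : ∀ (s : List Letter) (cs : List Bool) a b → length cs ≡ length s →
  zip (s ++ a ∷ []) (cs ++ b ∷ []) ≡ zip s cs ++ (a , b) ∷ []
zip-∷ʳ []      []       a b e = refl
zip-∷ʳ (x ∷ s) (c ∷ cs) a b e = cong ((x , c) ∷_) (zip-∷ʳ s cs a b (ℕP.suc-injective e))

-- A cut at the moved letter: the block it starts is moved from the front to the back.
rotate-cut : ∀ a p w → blocksAt (close ([] , (a ∷ proj₁ p) ∷ proj₂ p)) w
                     ≡ blocksAt (close (proj₁ p , proj₂ p ++ (a ∷ []) ∷ [])) w
rotate-cut a (l , []) w rewrite LP.++-identityʳ (a ∷ l) = refl
rotate-cut a (l , c ∷ cs) w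
  rewrite appendLast-[] (c ∷ cs) | appendLast-∷ʳ (c ∷ cs) (a ∷ []) l =
  cong (λ v → valueAt v w) (parseValue-rotate (a ∷ l) (c ∷ cs))

-- No cut at the moved letter: it stays inside the wrapped-around last block.
rotate-noCut : ∀ a p w → blocksAt (close (a ∷ proj₁ p , proj₂ p)) w ≡ blocksAt (close (extendLast p a)) w
rotate-noCut a (l , []) w = refl
rotate-noCut a (l , c ∷ cs) w
  rewrite close-appendLast l c cs (a ∷ []) | appendLast-++ c cs (a ∷ []) l = refl

contrib-rotate : ∀ a s b cs w → length cs ≡ length s →
  contrib (a ∷ s) w (b ∷ cs) ≡ contrib (s ++ a ∷ []) w (cs ++ b ∷ [])
contrib-rotate a s true cs w e
  rewrite contrib-close (a ∷ s) w (true ∷ cs) | contrib-close (s ++ a ∷ []) w (cs ++ true ∷ [])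
        | zip-∷ʳ s cs a true e | splitAtCuts-∷ʳ-cut (zip s cs) a
  = rotate-cut a (splitAtCuts (zip s cs)) w
contrib-rotate a s false cs w e
  rewrite contrib-close (a ∷ s) w (false ∷ cs) | contrib-close (s ++ a ∷ []) w (cs ++ false ∷ [])
        | zip-∷ʳ s cs a false e | splitAtCuts-∷ʳ-noCut (zip s cs) a
  = rotate-noCut a (splitAtCuts (zip s cs)) w

length-∷ʳ : ∀ {T : Set} (s : List T) a → length (s ++ a ∷ []) ≡ suc (length s)
length-∷ʳ s a = trans (LP.length-++ s) (ℕP.+-comm (length s) 1)

-- Rotating one letter: the two halves of the sum (cut / no cut at that letter)
-- are matched term by term.
coeff-rotate₁ : ∀ a s w → coeff (a ∷ s) w ≡ coeff (s ++ a ∷ []) w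
coeff-rotate₁ a s w = begin
  ΣCuts (suc n) (contrib (a ∷ s) w)
    ≡⟨ ΣCuts-first n (contrib (a ∷ s) w) ⟩
  ΣCuts n (λ c → contrib (a ∷ s) w (true ∷ c)) ℤ.+ ΣCuts n (λ c → contrib (a ∷ s) w (false ∷ c))
    ≡⟨ cong₂ ℤ._+_ (ΣCuts-cong n _ _ (λ cs e → contrib-rotate a s true cs w e))
                   (ΣCuts-cong n _ _ (λ cs e → contrib-rotate a s false cs w e)) ⟩
  ΣCuts n (λ c → contrib s' w (c ++ true ∷ [])) ℤ.+ ΣCuts n (λ c → contrib s' w (c ++ false ∷ []))
    ≡⟨ sym (ΣCuts-last n (contrib s' w)) ⟩
  ΣCuts (suc n) (contrib s' w)
    ≡⟨ cong (λ m → ΣCuts m (contrib s' w)) (sym (length-∷ʳ s a)) ⟩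
  ΣCuts (length s') (contrib s' w) ∎
  where
  n  = length s
  s' = s ++ a ∷ []

coeff-rotate : ∀ u v w → coeff (u ++ v) w ≡ coeff (v ++ u) w
coeff-rotate []      v w = cong (λ m → coeff m w) (sym (LP.++-identityʳ v))
coeff-rotate (a ∷ u) v w = begin
  coeff (a ∷ u ++ v) w            ≡⟨ coeff-rotate₁ a (u ++ v) w ⟩
  coeff ((u ++ v) ++ a ∷ []) w    ≡⟨ cong (λ m → coeff m w) (LP.++-assoc u v (a ∷ [])) ⟩
  coeff (u ++ v ++ a ∷ []) w      ≡⟨ coeff-rotate u (v ++ a ∷ []) w ⟩
  coeff ((v ++ a ∷ []) ++ u) w    ≡⟨ cong (λ m → coeff m w) (LP.++-assoc v (a ∷ []) u) ⟩
  coeff (v ++ a ∷ u) w            ∎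

reversal-rotate : ∀ u v w → coeff (v ++ u) w ≡ coeff (reverse (v ++ u)) w →
  coeff (u ++ v) w ≡ coeff (reverse (u ++ v)) w
reversal-rotate u v w sym-vu = begin
  coeff (u ++ v) w                         ≡⟨ coeff-rotate u v w ⟩
  coeff (v ++ u) w                         ≡⟨ sym-vu ⟩
  coeff (reverse (v ++ u)) w               ≡⟨ cong (λ m → coeff m w) (LP.reverse-++ v u) ⟩
  coeff (reverse u ++ reverse v) w         ≡⟨ coeff-rotate (reverse u) (reverse v) w ⟩
  coeff (reverse v ++ reverse u) w         ≡⟨ cong (λ m → coeff m w) (sym (LP.reverse-++ u v)) ⟩
  coeff (reverse (u ++ v)) w               ∎

-- The open-block sum  openGF o s w:  sum over cut sets of the linear string s
-- of the weight-w coefficient of the parsing whose first block is o followed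
-- by the letters of s before the first cut.

openBlocks : List Letter → List Letter → List Bool → List (List Letter)
openBlocks o s cs = (o ++ proj₁ (splitAtCuts (zip s cs))) ∷ proj₂ (splitAtCuts (zip s cs))

openTerm : List Letter → List Letter → ℕ → List Bool → ℤ
openTerm o s w cs = valueAt (parseValue (openBlocks o s cs)) w

openGF : List Letter → List Letter → ℕ → ℤ
openGF o s w = ΣCuts (length s) (openTerm o s w)

-- Recurrence on the next letter x: either a cut closes the block o before x,
-- or x joins the open block.
openGF-∷ : ∀ o x s w → openGF o (x ∷ s) w
  ≡ ΣCuts (length s) (λ cs → valueAt (parseValue (o ∷ openBlocks (x ∷ []) s cs)) w) ℤ.+ openGF (o ++ x ∷ []) s w
openGF-∷ o x s w =
  trans (ΣCuts-first (length s) (openTerm o (x ∷ s) w))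
        (cong₂ ℤ._+_ (ΣCuts-cong (length s) _ _ λ cs _ → closeBefore cs)
                     (ΣCuts-cong (length s) _ _ λ cs _ → join cs))
  where
  closeBefore : ∀ cs → openTerm o (x ∷ s) w (true ∷ cs) ≡ valueAt (parseValue (o ∷ openBlocks (x ∷ []) s cs)) w
  closeBefore cs = cong (λ b → valueAt (parseValue (b ∷ openBlocks (x ∷ []) s cs)) w) (LP.++-identityʳ o)
  join : ∀ cs → openTerm o (x ∷ s) w (false ∷ cs) ≡ openTerm (o ++ x ∷ []) s w cs
  join cs = cong (λ b → valueAt (parseValue (b ∷ proj₂ (splitAtCuts (zip s cs)))) w)
                 (sym (LP.++-assoc o (x ∷ []) _))

openGF-∷-dead : ∀ o x s w → wordData o ≡ nothing → openGF o (x ∷ s) w ≡ openGF (o ++ x ∷ []) s w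
openGF-∷-dead o x s w dead =
  trans (openGF-∷ o x s w)
        (trans (cong (ℤ._+ openGF (o ++ x ∷ []) s w)
                     (ΣCuts-zero (length s) _ λ cs _ → valueAt-dead o (openBlocks (x ∷ []) s cs) w dead))
               (ℤP.+-identityˡ _))

openGF-∷-negWord : ∀ o x s w → wordData o ≡ just (-1ℤ , 1) →
  openGF o (x ∷ s) w ≡ negT (openGF (x ∷ []) s) w ℤ.+ openGF (o ++ x ∷ []) s w
openGF-∷-negWord o x s w neg =
  trans (openGF-∷ o x s w)
        (cong (ℤ._+ openGF (o ++ x ∷ []) s w)
              (trans (ΣCuts-cong (length s) _ (λ cs → negT (λ v → openTerm (x ∷ []) s v cs) w)
                                 λ cs _ → valueAt-negWord o (openBlocks (x ∷ []) s cs) w neg)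
                     (ΣCuts-negT (length s) (λ cs v → openTerm (x ∷ []) s v cs) w)))

openGF-[]-dead : ∀ o w → wordData o ≡ nothing → openGF o [] w ≡ 0ℤ
openGF-[]-dead o w dead rewrite LP.++-identityʳ o | valueAt-dead o [] w dead = refl

openGF-[]-negWord : ∀ o w → wordData o ≡ just (-1ℤ , 1) → openGF o [] w ≡ negT (valueAt unit) w
openGF-[]-negWord o w neg rewrite LP.++-identityʳ o | valueAt-negWord o [] w neg = ℤP.+-identityʳ _

dead⇒notWord : ∀ o → (∀ v → wordData (o ++ v) ≡ nothing) → wordData o ≡ nothing
dead⇒notWord o dead = trans (cong wordData (sym (LP.++-identityʳ o))) (dead [])

openGF-dead : ∀ o s w → (∀ v → wordData (o ++ v) ≡ nothing) → openGF o s w ≡ 0ℤ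
openGF-dead o []      w dead = openGF-[]-dead o w (dead⇒notWord o dead)
openGF-dead o (x ∷ s) w dead =
  trans (openGF-∷-dead o x s w (dead⇒notWord o dead))
        (openGF-dead (o ++ x ∷ []) s w λ v → trans (cong wordData (LP.++-assoc o (x ∷ []) v)) (dead (x ∷ v)))

data AB : Letter → Set where
  isA : AB A
  isB : AB B

tiles : List Letter → Maybe ℕ
tiles []                = just 0
tiles (B ∷ A ∷ r)       = M.map suc (tiles r)
tiles (A ∷ A ∷ A ∷ r)   = M.map suc (tiles r)
tiles (A ∷ B ∷ A ∷ r)   = M.map suc (tiles r)
tiles _                 = nothing

monomial : Maybe ℕ → ℕ → ℤ
monomial nothing  w = 0ℤ
monomial (just k) w = valueAt (just (-1ℤ ℤ.^ k , k)) w

negT-monomial : ∀ m w → negT (monomial m) w ≡ monomial (M.map suc m) w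
negT-monomial nothing  zero    = refl
negT-monomial nothing  (suc w) = ℤP.*-zeroʳ -1ℤ
negT-monomial (just k) w       = sym (valueAt-negT (just (-1ℤ ℤ.^ k , k)) w)

noLongWord : ∀ a b c d r → wordData (a ∷ b ∷ c ∷ d ∷ r) ≡ nothing
noLongWord A A A d r = refl
noLongWord A A X d r = refl
noLongWord A A B d r = refl
noLongWord A X A d r = refl
noLongWord A X X d r = refl
noLongWord A X B d r = refl
noLongWord A B A d r = refl
noLongWord A B X d r = refl
noLongWord A B B d r = refl
noLongWord X A A d r = refl
noLongWord X A X d r = refl
noLongWord X A B d r = refl
noLongWord X X A d r = refl
noLongWord X X X d r = refl
noLongWord X X B d r = refl
noLongWord X B A d r = refl
noLongWord X B X d r = refl
noLongWord X B B d r = refl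
noLongWord B A A d r = refl
noLongWord B A X d r = refl
noLongWord B A B d r = refl
noLongWord B X A d r = refl
noLongWord B X X d r = refl
noLongWord B X B d r = refl
noLongWord B B A d r = refl
noLongWord B B X d r = refl
noLongWord B B B d r = refl

deadAfter3 : ∀ a b c → wordData (a ∷ b ∷ c ∷ []) ≡ nothing → ∀ v → wordData (a ∷ b ∷ c ∷ v) ≡ nothing
deadAfter3 a b c dead []      = dead
deadAfter3 a b c dead (d ∷ v) = noLongWord a b c d v

deadBB : ∀ v → wordData (B ∷ B ∷ v) ≡ nothing
deadBB []          = refl
deadBB (A ∷ [])    = refl
deadBB (X ∷ [])    = refl
deadBB (B ∷ [])    = refl
deadBB (c ∷ d ∷ v) = noLongWord B B c d v

-- For X-free s the open-block sum is the monomial of the unique tiling: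
-- the open blocks reachable from a single letter are followed one letter at a
-- time until they become a word (BA, AAA, ABA) or can no longer become one.
mutual
  openGF-letter : ∀ y s → AB y → All AB s → ∀ w → openGF (y ∷ []) s w ≡ monomial (tiles (y ∷ s)) w
  openGF-letter A s isA ps w = openGF-A s ps w
  openGF-letter B s isB ps w = openGF-B s ps w

  openGF-A : ∀ s → All AB s → ∀ w → openGF (A ∷ []) s w ≡ monomial (tiles (A ∷ s)) w
  openGF-A []      []          w = refl
  openGF-A (A ∷ s) (isA ∷ ps) w = trans (openGF-∷-dead (A ∷ []) A s w refl) (openGF-AA s ps w)
  openGF-A (B ∷ s) (isB ∷ ps) w = trans (openGF-∷-dead (A ∷ []) B s w refl) (openGF-AB s ps w)

  openGF-B : ∀ s → All AB s → ∀ w → openGF (B ∷ []) s w ≡ monomial (tiles (B ∷ s)) w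
  openGF-B []      []          w = refl
  openGF-B (A ∷ s) (isA ∷ ps) w =
    trans (openGF-∷-dead (B ∷ []) A s w refl) (openGF-word (B ∷ A ∷ []) refl deadBA s ps w)
    where
    deadBA : ∀ y v → wordData (B ∷ A ∷ y ∷ v) ≡ nothing
    deadBA A v = deadAfter3 B A A refl v
    deadBA X v = deadAfter3 B A X refl v
    deadBA B v = deadAfter3 B A B refl v
  openGF-B (B ∷ s) (isB ∷ ps) w =
    trans (openGF-∷-dead (B ∷ []) B s w refl) (openGF-dead (B ∷ B ∷ []) s w deadBB)

  openGF-AA : ∀ s → All AB s → ∀ w → openGF (A ∷ A ∷ []) s w ≡ monomial (tiles (A ∷ A ∷ s)) w
  openGF-AA []      []          w = refl
  openGF-AA (A ∷ s) (isA ∷ ps) w =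
    trans (openGF-∷-dead (A ∷ A ∷ []) A s w refl) (openGF-word (A ∷ A ∷ A ∷ []) refl (noLongWord A A A) s ps w)
  openGF-AA (B ∷ s) (isB ∷ ps) w =
    trans (openGF-∷-dead (A ∷ A ∷ []) B s w refl) (openGF-dead (A ∷ A ∷ B ∷ []) s w (deadAfter3 A A B refl))

  openGF-AB : ∀ s → All AB s → ∀ w → openGF (A ∷ B ∷ []) s w ≡ monomial (tiles (A ∷ B ∷ s)) w
  openGF-AB []      []          w = refl
  openGF-AB (A ∷ s) (isA ∷ ps) w =
    trans (openGF-∷-dead (A ∷ B ∷ []) A s w refl) (openGF-word (A ∷ B ∷ A ∷ []) refl (noLongWord A B A) s ps w)
  openGF-AB (B ∷ s) (isB ∷ ps) w =
    trans (openGF-∷-dead (A ∷ B ∷ []) B s w refl) (openGF-dead (A ∷ B ∷ B ∷ []) s w (deadAfter3 A B B refl))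

  -- o is one of the words BA, AAA, ABA: either it is closed (a factor −t)
  -- or it swallows the next letter and dies.
  openGF-word : ∀ o → wordData o ≡ just (-1ℤ , 1) → (∀ y v → wordData (o ++ y ∷ v) ≡ nothing) →
    ∀ s → All AB s → ∀ w → openGF o s w ≡ monomial (M.map suc (tiles s)) w
  openGF-word o neg dead []      []         w = trans (openGF-[]-negWord o w neg) (negT-monomial (just 0) w)
  openGF-word o neg dead (y ∷ s) (py ∷ ps) w = begin
    openGF o (y ∷ s) w
      ≡⟨ openGF-∷-negWord o y s w neg ⟩
    negT (openGF (y ∷ []) s) w ℤ.+ openGF (o ++ y ∷ []) s w
      ≡⟨ cong₂ ℤ._+_ (negT-cong _ _ (openGF-letter y s py ps) w) (openGF-dead (o ++ y ∷ []) s w swallowed) ⟩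
    negT (monomial (tiles (y ∷ s))) w ℤ.+ 0ℤ
      ≡⟨ ℤP.+-identityʳ _ ⟩
    negT (monomial (tiles (y ∷ s))) w
      ≡⟨ negT-monomial (tiles (y ∷ s)) w ⟩
    monomial (M.map suc (tiles (y ∷ s))) w ∎
    where
    swallowed : ∀ v → wordData ((o ++ y ∷ []) ++ v) ≡ nothing
    swallowed v = trans (cong wordData (LP.++-assoc o (y ∷ []) v)) (dead y v)

-- Split the cut sets according to the cuts at
-- B and at a: a cut at B gives the tilings of B y a; no cut at B but a cut at
-- a gives the tilings of a B y; if neither, the block containing B has at
-- least two letters before B and is not a word.

contrib-cutAtStart : ∀ a s w cs → contrib (a ∷ s) w (true ∷ cs) ≡ openTerm (a ∷ []) s w cs
contrib-cutAtStart a s w cs rewrite contrib-close (a ∷ s) w (true ∷ cs) =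
  cong (λ bs → valueAt (parseValue bs) w) (appendLast-[] (openBlocks (a ∷ []) s cs))

ΣCuts-cutAtStart : ∀ a s w → ΣCuts (length s) (λ cs → contrib (a ∷ s) w (true ∷ cs)) ≡ openGF (a ∷ []) s w
ΣCuts-cutAtStart a s w = ΣCuts-cong (length s) _ _ (λ cs _ → contrib-cutAtStart a s w cs)

data NonEmpty : List Letter → Set where
  nonEmpty : ∀ x r → NonEmpty (x ∷ r)

blocks-nonEmpty : ∀ z → All NonEmpty (proj₂ (splitAtCuts z))
blocks-nonEmpty []                = []
blocks-nonEmpty ((x , true) ∷ r)  = nonEmpty x _ ∷ blocks-nonEmpty r
blocks-nonEmpty ((x , false) ∷ r) = blocks-nonEmpty r

lastOf : List Letter → List (List Letter) → List Letter
lastOf c []        = c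
lastOf c (c' ∷ cs) = lastOf c' cs

lastOf-nonEmpty : ∀ c cs → All NonEmpty (c ∷ cs) → NonEmpty (lastOf c cs)
lastOf-nonEmpty c []        (ne ∷ _)   = ne
lastOf-nonEmpty c (c' ∷ cs) (_ ∷ nes) = lastOf-nonEmpty c' cs nes

parseValue-deadLast : ∀ c cs l → wordData (lastOf c cs ++ l) ≡ nothing →
  parseValue (appendLast (c ∷ cs) l) ≡ nothing
parseValue-deadLast c []        l dead rewrite parseValue-∷ (c ++ l) [] | dead = refl
parseValue-deadLast c (c' ∷ cs) l dead
  rewrite parseValue-∷ c (appendLast (c' ∷ cs) l) | parseValue-deadLast c' cs l dead = ⊗-zeroʳ (wordData c)

-- In every word, B is preceded by at most one letter.
deadBefore-B : ∀ b l a → NonEmpty b → wordData (b ++ a ∷ B ∷ l) ≡ nothing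
deadBefore-B (p ∷ [])                l a (nonEmpty _ _) = short p a l
  where
  short : ∀ p a l → wordData (p ∷ a ∷ B ∷ l) ≡ nothing
  short p a (d ∷ r) = noLongWord p a B d r
  short A A [] = refl
  short A X [] = refl
  short A B [] = refl
  short X A [] = refl
  short X X [] = refl
  short X B [] = refl
  short B A [] = refl
  short B X [] = refl
  short B B [] = refl
deadBefore-B (p ∷ q ∷ [])            l a (nonEmpty _ _) = noLongWord p q a B l
deadBefore-B (p ∷ q ∷ q' ∷ [])       l a (nonEmpty _ _) = noLongWord p q q' a (B ∷ l)
deadBefore-B (p ∷ q ∷ q' ∷ q'' ∷ qs) l a (nonEmpty _ _) = noLongWord p q q' q'' (qs ++ a ∷ B ∷ l)

contrib-noCutAtBOrLast : ∀ y a cs w → length cs ≡ length y →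
  contrib (B ∷ y ++ a ∷ []) w (false ∷ cs ++ false ∷ []) ≡ 0ℤ
contrib-noCutAtBOrLast y a cs w e
  rewrite contrib-close (B ∷ y ++ a ∷ []) w (false ∷ cs ++ false ∷ [])
        | zip-∷ʳ y cs a false e | splitAtCuts-∷ʳ-noCut (zip y cs) a
  = wrapped (splitAtCuts (zip y cs)) (blocks-nonEmpty (zip y cs))
  where
  wrapped : ∀ p → All NonEmpty (proj₂ p) →
    blocksAt (close (B ∷ proj₁ (extendLast p a) , proj₂ (extendLast p a))) w ≡ 0ℤ
  wrapped (l , [])     _   = refl
  wrapped (l , c ∷ cs) nes
    rewrite close-appendLast (B ∷ l) c cs (a ∷ []) | appendLast-++ c cs (a ∷ []) (B ∷ l)
          | parseValue-deadLast c cs (a ∷ B ∷ l) (deadBefore-B (lastOf c cs) l a (lastOf-nonEmpty c cs nes))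
    = refl

contrib-singleton : ∀ a y cs w → AB a → contrib (a ∷ B ∷ y) w (true ∷ true ∷ cs) ≡ 0ℤ
contrib-singleton a y cs w pa =
  trans (contrib-cutAtStart a (B ∷ y) w (true ∷ cs))
        (valueAt-dead (a ∷ []) (openBlocks (B ∷ []) y cs) w (notWord pa))
  where
  notWord : ∀ {a} → AB a → wordData (a ∷ []) ≡ nothing
  notWord isA = refl
  notWord isB = refl

-- The cut sets with no cut at B: by rotation, the tilings of a B y.
ΣCuts-noCutAtB : ∀ y a → AB a → ∀ w →
  ΣCuts (length (y ++ a ∷ [])) (λ cs → contrib (B ∷ y ++ a ∷ []) w (false ∷ cs))
  ≡ openGF (a ∷ []) (B ∷ y) w
ΣCuts-noCutAtB y a pa w = begin
  ΣCuts (length (y ++ a ∷ [])) F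
    ≡⟨ cong (λ m → ΣCuts m F) (length-∷ʳ y a) ⟩
  ΣCuts (suc n) F
    ≡⟨ ΣCuts-last n F ⟩
  ΣCuts n (λ c → F (c ++ true ∷ [])) ℤ.+ ΣCuts n (λ c → F (c ++ false ∷ []))
    ≡⟨ cong₂ ℤ._+_ (ΣCuts-cong n _ _ λ c e → sym (contrib-rotate a (B ∷ y) true (false ∷ c) w (cong suc e)))
                   (ΣCuts-zero n _ λ c e → contrib-noCutAtBOrLast y a c w e) ⟩
  ΣCuts n (λ c → G (false ∷ c)) ℤ.+ 0ℤ
    ≡⟨ ℤP.+-identityʳ _ ⟩
  ΣCuts n (λ c → G (false ∷ c))
    ≡⟨ sym (ℤP.+-identityˡ _) ⟩
  0ℤ ℤ.+ ΣCuts n (λ c → G (false ∷ c))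
    ≡⟨ cong (ℤ._+ ΣCuts n (λ c → G (false ∷ c))) (sym (ΣCuts-zero n _ λ c _ → contrib-singleton a y c w pa)) ⟩
  ΣCuts n (λ c → G (true ∷ c)) ℤ.+ ΣCuts n (λ c → G (false ∷ c))
    ≡⟨ sym (ΣCuts-first n G) ⟩
  ΣCuts (suc n) G
    ≡⟨ ΣCuts-cutAtStart a (B ∷ y) w ⟩
  openGF (a ∷ []) (B ∷ y) w ∎
  where
  n = length y
  F : List Bool → ℤ
  F cs = contrib (B ∷ y ++ a ∷ []) w (false ∷ cs)
  G : List Bool → ℤ
  G cs = contrib (a ∷ B ∷ y) w (true ∷ cs)

coeff-cyclic : ∀ y a → All AB y → AB a → ∀ w →
  coeff (B ∷ y ++ a ∷ []) w ≡ monomial (tiles (B ∷ y ++ a ∷ [])) w ℤ.+ monomial (tiles (a ∷ B ∷ y)) w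
coeff-cyclic y a py pa w =
  trans (ΣCuts-first (length (y ++ a ∷ [])) (contrib (B ∷ y ++ a ∷ []) w))
        (cong₂ ℤ._+_ (trans (ΣCuts-cutAtStart B (y ++ a ∷ []) w) (openGF-B (y ++ a ∷ []) (AllP.∷ʳ⁺ py pa) w))
                     (trans (ΣCuts-noCutAtB y a pa w) (openGF-letter a (B ∷ y) pa (isB ∷ py) w)))

As : ℕ → List Letter
As k = replicate k A

fromRuns : List ℕ → List Letter
fromRuns []       = []
fromRuns (r ∷ rs) = B ∷ As r ++ fromRuns rs

linRuns : ℕ → List ℕ → Maybe ℕ
linRuns (suc (suc (suc k))) rs = M.map suc (linRuns k rs)
linRuns 0 []           = just 0
linRuns 0 (0 ∷ rs)     = nothing
linRuns 0 (suc r ∷ rs) = M.map suc (linRuns r rs)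
linRuns 1 []           = nothing
linRuns 1 (r ∷ rs)     = linRuns 0 (r ∷ rs)
linRuns 2 _            = nothing

tiles-runs : ∀ k rs → tiles (As k ++ fromRuns rs) ≡ linRuns k rs
tiles-runs (suc (suc (suc k))) rs = cong (M.map suc) (tiles-runs k rs)
tiles-runs 0 []               = refl
tiles-runs 0 (0 ∷ [])         = refl
tiles-runs 0 (0 ∷ r ∷ rs)     = refl
tiles-runs 0 (suc r ∷ rs)     = cong (M.map suc) (tiles-runs r rs)
tiles-runs 1 []               = refl
tiles-runs 1 (0 ∷ [])         = refl
tiles-runs 1 (0 ∷ r ∷ rs)     = refl
tiles-runs 1 (suc r ∷ rs)     = cong (M.map suc) (tiles-runs r rs)
tiles-runs 2 []               = refl
tiles-runs 2 (r ∷ rs)         = refl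

infixr 6 _⊙_
_⊙_ : Maybe ℕ → Maybe ℕ → Maybe ℕ
just a ⊙ just b = just (a ℕ.+ b)
_      ⊙ _      = nothing

⊙-identityˡ : ∀ a → just 0 ⊙ a ≡ a
⊙-identityˡ (just a) = refl
⊙-identityˡ nothing  = refl

⊙-identityʳ : ∀ a → a ⊙ just 0 ≡ a
⊙-identityʳ (just a) = cong just (ℕP.+-identityʳ a)
⊙-identityʳ nothing  = refl

⊙-zeroʳ : ∀ a → a ⊙ nothing ≡ nothing
⊙-zeroʳ (just a) = refl
⊙-zeroʳ nothing  = refl

⊙-comm : ∀ a b → a ⊙ b ≡ b ⊙ a
⊙-comm (just a) (just b) = cong just (ℕP.+-comm a b)
⊙-comm (just a) nothing  = refl
⊙-comm nothing  (just b) = refl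
⊙-comm nothing  nothing  = refl

⊙-assoc : ∀ a b c → (a ⊙ b) ⊙ c ≡ a ⊙ (b ⊙ c)
⊙-assoc (just a) (just b) (just c) = cong just (ℕP.+-assoc a b c)
⊙-assoc nothing  b        c        = refl
⊙-assoc (just a) nothing  c        = refl
⊙-assoc (just a) (just b) nothing  = refl

map-suc-⊙ : ∀ a b → M.map suc (a ⊙ b) ≡ M.map suc a ⊙ b
map-suc-⊙ (just a) (just b) = refl
map-suc-⊙ (just a) nothing  = refl
map-suc-⊙ nothing  b        = refl

-- runTail m: the AAA blocks in the m letters of a run after its BA block,
-- the last A being lent to the next ABA block when m ≡ 1 (mod 3).
runTail : ℕ → Maybe ℕ
runTail 0                   = just 0
runTail 1                   = just 0
runTail 2                   = nothing
runTail (suc (suc (suc m))) = M.map suc (runTail m)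

-- runBlocks r: the blocks owned by a run B A^r (its B-block and its AAA blocks).
runBlocks : ℕ → Maybe ℕ
runBlocks 0       = nothing
runBlocks (suc m) = M.map suc (runTail m)

cycRuns : List ℕ → Maybe ℕ
cycRuns = foldr (λ r acc → runBlocks r ⊙ acc) (just 0)

cycRuns-++ : ∀ xs ys → cycRuns (xs ++ ys) ≡ cycRuns xs ⊙ cycRuns ys
cycRuns-++ []       ys = sym (⊙-identityˡ _)
cycRuns-++ (x ∷ xs) ys =
  trans (cong (runBlocks x ⊙_) (cycRuns-++ xs ys)) (sym (⊙-assoc (runBlocks x) (cycRuns xs) (cycRuns ys)))

cycRuns-reverse : ∀ rs → cycRuns (reverse rs) ≡ cycRuns rs
cycRuns-reverse []       = refl
cycRuns-reverse (x ∷ rs) = begin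
  cycRuns (reverse (x ∷ rs))
    ≡⟨ cong cycRuns (LP.unfold-reverse x rs) ⟩
  cycRuns (reverse rs ++ x ∷ [])
    ≡⟨ cycRuns-++ (reverse rs) (x ∷ []) ⟩
  cycRuns (reverse rs) ⊙ (runBlocks x ⊙ just 0)
    ≡⟨ cong₂ _⊙_ (cycRuns-reverse rs) (⊙-identityʳ (runBlocks x)) ⟩
  cycRuns rs ⊙ runBlocks x
    ≡⟨ ⊙-comm (cycRuns rs) (runBlocks x) ⟩
  cycRuns (x ∷ rs) ∎

-- Closing the linear sentence fromRuns
-- (rs ++ r+1) into a cycle, its last A either stays in the last run or is lent
-- to the first B; exactly these two linear tilings can exist, never both.

linRuns-lead : ∀ m t ts → linRuns m (t ∷ ts) ≡ runTail m ⊙ linRuns 0 (t ∷ ts)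
linRuns-lead 0 t ts = sym (⊙-identityˡ _)
linRuns-lead 1 t ts = sym (⊙-identityˡ _)
linRuns-lead 2 t ts = refl
linRuns-lead (suc (suc (suc m))) t ts = trans (cong (M.map suc) (linRuns-lead m t ts)) (map-suc-⊙ (runTail m) _)

linRuns-∷ : ∀ r t ts → linRuns 0 (r ∷ t ∷ ts) ≡ runBlocks r ⊙ linRuns 0 (t ∷ ts)
linRuns-∷ 0       t ts = refl
linRuns-∷ (suc m) t ts = trans (cong (M.map suc) (linRuns-lead m t ts)) (map-suc-⊙ (runTail m) _)

linRuns-∷-∷ʳ : ∀ x ys z → linRuns 0 (x ∷ ys ++ z ∷ []) ≡ runBlocks x ⊙ linRuns 0 (ys ++ z ∷ [])
linRuns-∷-∷ʳ x []       z = linRuns-∷ x z []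
linRuns-∷-∷ʳ x (y ∷ ys) z = linRuns-∷ x y (ys ++ z ∷ [])

linRuns-1-∷ʳ : ∀ rs r → linRuns 1 (rs ++ r ∷ []) ≡ linRuns 0 (rs ++ r ∷ [])
linRuns-1-∷ʳ []      r = refl
linRuns-1-∷ʳ (x ∷ _) r = refl

linRuns-single-+3 : ∀ m → linRuns 0 (suc (suc (suc m)) ∷ []) ≡ M.map suc (linRuns 0 (m ∷ []))
linRuns-single-+3 0       = refl
linRuns-single-+3 (suc m) = refl

<∣>-map-suc : ∀ a b → M.map suc a <∣> M.map suc b ≡ M.map suc (a <∣> b)
<∣>-map-suc (just a) b = refl
<∣>-map-suc nothing  b = refl

<∣>-⊙ : ∀ s a b → (s ⊙ a) <∣> (s ⊙ b) ≡ s ⊙ (a <∣> b)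
<∣>-⊙ nothing  a        b = refl
<∣>-⊙ (just s) (just a) b = refl
<∣>-⊙ (just s) nothing  b = refl

linRuns-single-cyclic : ∀ r → linRuns 0 (suc r ∷ []) <∣> linRuns 0 (r ∷ []) ≡ runBlocks (suc r) ⊙ just 0
linRuns-single-cyclic 0 = refl
linRuns-single-cyclic 1 = refl
linRuns-single-cyclic 2 = refl
linRuns-single-cyclic (suc (suc (suc m))) rewrite linRuns-single-+3 m =
  trans (<∣>-map-suc (linRuns 0 (suc m ∷ [])) (linRuns 0 (m ∷ [])))
        (trans (cong (M.map suc) (linRuns-single-cyclic m)) (map-suc-⊙ (runBlocks (suc m)) (just 0)))

linRuns-single-exclusive : ∀ r → linRuns 0 (suc r ∷ []) ≡ nothing ⊎ linRuns 0 (r ∷ []) ≡ nothing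
linRuns-single-exclusive 0 = inj₂ refl
linRuns-single-exclusive 1 = inj₁ refl
linRuns-single-exclusive 2 = inj₁ refl
linRuns-single-exclusive (suc (suc (suc m))) rewrite linRuns-single-+3 m with linRuns-single-exclusive m
... | inj₁ e = inj₁ (cong (M.map suc) e)
... | inj₂ e = inj₂ (cong (M.map suc) e)

linRuns-cyclic : ∀ rs r →
  linRuns 0 (rs ++ suc r ∷ []) <∣> linRuns 0 (rs ++ r ∷ []) ≡ cycRuns (rs ++ suc r ∷ [])
linRuns-cyclic []       r = linRuns-single-cyclic r
linRuns-cyclic (x ∷ rs) r rewrite linRuns-∷-∷ʳ x rs (suc r) | linRuns-∷-∷ʳ x rs r =
  trans (<∣>-⊙ (runBlocks x) _ _) (cong (runBlocks x ⊙_) (linRuns-cyclic rs r))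

linRuns-exclusive : ∀ rs r → linRuns 0 (rs ++ suc r ∷ []) ≡ nothing ⊎ linRuns 0 (rs ++ r ∷ []) ≡ nothing
linRuns-exclusive []       r = linRuns-single-exclusive r
linRuns-exclusive (x ∷ rs) r rewrite linRuns-∷-∷ʳ x rs (suc r) | linRuns-∷-∷ʳ x rs r with linRuns-exclusive rs r
... | inj₁ e rewrite e = inj₁ (⊙-zeroʳ (runBlocks x))
... | inj₂ e rewrite e = inj₂ (⊙-zeroʳ (runBlocks x))

-- A run of length 0 (two adjacent B) admits no tiling at all.
linRuns-last-0 : ∀ rs → linRuns 0 (rs ++ 0 ∷ []) ≡ nothing
linRuns-last-0 []       = refl
linRuns-last-0 (x ∷ rs) rewrite linRuns-∷-∷ʳ x rs 0 | linRuns-last-0 rs = ⊙-zeroʳ (runBlocks x)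

cycRuns-last-0 : ∀ rs → cycRuns (rs ++ 0 ∷ []) ≡ nothing
cycRuns-last-0 []       = refl
cycRuns-last-0 (x ∷ rs) rewrite cycRuns-last-0 rs = ⊙-zeroʳ (runBlocks x)

monomial-<∣> : ∀ a b w → a ≡ nothing ⊎ b ≡ nothing → monomial a w ℤ.+ monomial b w ≡ monomial (a <∣> b) w
monomial-<∣> .nothing b        w (inj₁ refl) = ℤP.+-identityˡ _
monomial-<∣> (just a) .nothing w (inj₂ refl) = ℤP.+-identityʳ _
monomial-<∣> nothing  .nothing w (inj₂ refl) = refl

As-∷ʳ : ∀ k → As k ++ A ∷ [] ≡ A ∷ As k
As-∷ʳ zero    = refl
As-∷ʳ (suc k) = cong (A ∷_) (As-∷ʳ k)

As-AB : ∀ k → All AB (As k)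
As-AB zero    = []
As-AB (suc k) = isA ∷ As-AB k

fromRuns-AB : ∀ rs → All AB (fromRuns rs)
fromRuns-AB []       = []
fromRuns-AB (r ∷ rs) = isB ∷ AllP.++⁺ (As-AB r) (fromRuns-AB rs)

fromRuns-++ : ∀ xs ys → fromRuns (xs ++ ys) ≡ fromRuns xs ++ fromRuns ys
fromRuns-++ []       ys = refl
fromRuns-++ (x ∷ xs) ys =
  cong (B ∷_) (trans (cong (As x ++_) (fromRuns-++ xs ys)) (sym (LP.++-assoc (As x) (fromRuns xs) (fromRuns ys))))

afterB : List ℕ → List Letter
afterB []       = []
afterB (r ∷ rs) = As r ++ fromRuns rs

fromRuns-∷ʳ : ∀ rs r → fromRuns (rs ++ r ∷ []) ≡ B ∷ afterB (rs ++ r ∷ [])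
fromRuns-∷ʳ []      r = refl
fromRuns-∷ʳ (x ∷ _) r = refl

fromRuns-∷ʳ-suc : ∀ rs r → fromRuns (rs ++ suc r ∷ []) ≡ fromRuns (rs ++ r ∷ []) ++ A ∷ []
fromRuns-∷ʳ-suc []       r rewrite LP.++-identityʳ (As r) = cong (B ∷_) (sym (As-∷ʳ r))
fromRuns-∷ʳ-suc (x ∷ rs) r rewrite fromRuns-∷ʳ-suc rs r =
  cong (B ∷_) (sym (LP.++-assoc (As x) (fromRuns (rs ++ r ∷ [])) (A ∷ [])))

coeff-fromRuns : ∀ rs r w → coeff (fromRuns (rs ++ r ∷ [])) w ≡ monomial (cycRuns (rs ++ r ∷ [])) w
coeff-fromRuns rs (suc r) w = begin
  coeff (fromRuns (rs ++ suc r ∷ [])) w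
    ≡⟨ cong (λ m → coeff m w) shape ⟩
  coeff (B ∷ y ++ A ∷ []) w
    ≡⟨ coeff-cyclic y A y-AB isA w ⟩
  monomial (tiles (B ∷ y ++ A ∷ [])) w ℤ.+ monomial (tiles (A ∷ B ∷ y)) w
    ≡⟨ cong₂ (λ a b → monomial a w ℤ.+ monomial b w) keepLastA lendLastA ⟩
  monomial (linRuns 0 (rs ++ suc r ∷ [])) w ℤ.+ monomial (linRuns 0 (rs ++ r ∷ [])) w
    ≡⟨ monomial-<∣> _ _ w (linRuns-exclusive rs r) ⟩
  monomial (linRuns 0 (rs ++ suc r ∷ []) <∣> linRuns 0 (rs ++ r ∷ [])) w
    ≡⟨ cong (λ m → monomial m w) (linRuns-cyclic rs r) ⟩
  monomial (cycRuns (rs ++ suc r ∷ [])) w ∎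
  where
  y = afterB (rs ++ r ∷ [])
  shape : fromRuns (rs ++ suc r ∷ []) ≡ B ∷ y ++ A ∷ []
  shape = trans (fromRuns-∷ʳ-suc rs r) (cong (_++ A ∷ []) (fromRuns-∷ʳ rs r))
  y-AB : All AB y
  y-AB = All.tail (subst (All AB) (fromRuns-∷ʳ rs r) (fromRuns-AB (rs ++ r ∷ [])))
  keepLastA : tiles (B ∷ y ++ A ∷ []) ≡ linRuns 0 (rs ++ suc r ∷ [])
  keepLastA = trans (cong tiles (sym shape)) (tiles-runs 0 (rs ++ suc r ∷ []))
  lendLastA : tiles (A ∷ B ∷ y) ≡ linRuns 0 (rs ++ r ∷ [])
  lendLastA = trans (cong (λ m → tiles (A ∷ m)) (sym (fromRuns-∷ʳ rs r)))
                    (trans (tiles-runs 1 (rs ++ r ∷ [])) (linRuns-1-∷ʳ rs r))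
coeff-fromRuns []       zero w = refl
coeff-fromRuns (x ∷ rs) zero w = begin
  coeff (fromRuns (x ∷ rs ++ 0 ∷ [])) w
    ≡⟨ cong (λ m → coeff m w) shape ⟩
  coeff (B ∷ y ++ B ∷ []) w
    ≡⟨ coeff-cyclic y B y-AB isB w ⟩
  monomial (tiles (B ∷ y ++ B ∷ [])) w ℤ.+ 0ℤ
    ≡⟨ cong (λ m → monomial m w ℤ.+ 0ℤ) noTiling ⟩
  0ℤ
    ≡⟨ cong (λ m → monomial m w) (sym (cycRuns-last-0 (x ∷ rs))) ⟩
  monomial (cycRuns (x ∷ rs ++ 0 ∷ [])) w ∎
  where
  y = As x ++ fromRuns rs
  shape : fromRuns (x ∷ rs ++ 0 ∷ []) ≡ B ∷ y ++ B ∷ []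
  shape = cong (B ∷_) (trans (cong (As x ++_) (fromRuns-++ rs (0 ∷ [])))
                             (sym (LP.++-assoc (As x) (fromRuns rs) (B ∷ []))))
  y-AB : All AB y
  y-AB = AllP.++⁺ (As-AB x) (fromRuns-AB rs)
  noTiling : tiles (B ∷ y ++ B ∷ []) ≡ nothing
  noTiling = trans (cong tiles (sym shape)) (trans (tiles-runs 0 (x ∷ rs ++ 0 ∷ [])) (linRuns-last-0 (x ∷ rs)))

-- Reversal.  Reversing fromRuns (t ∷ ts) gives, up to rotation, fromRuns of
-- the reversed list of runs.

reverse-As : ∀ k → reverse (As k) ≡ As k
reverse-As zero    = refl
reverse-As (suc k) = begin
  reverse (A ∷ As k)      ≡⟨ LP.unfold-reverse A (As k) ⟩
  reverse (As k) ++ A ∷ [] ≡⟨ cong (_++ A ∷ []) (reverse-As k) ⟩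
  As k ++ A ∷ []          ≡⟨ As-∷ʳ k ⟩
  A ∷ As k                ∎

reverse-fromRuns-∷ : ∀ t ts → reverse (fromRuns (t ∷ ts)) ≡ (reverse (fromRuns ts) ++ As t) ++ B ∷ []
reverse-fromRuns-∷ t ts = begin
  reverse (B ∷ As t ++ fromRuns ts)
    ≡⟨ LP.unfold-reverse B (As t ++ fromRuns ts) ⟩
  reverse (As t ++ fromRuns ts) ++ B ∷ []
    ≡⟨ cong (_++ B ∷ []) (LP.reverse-++ (As t) (fromRuns ts)) ⟩
  (reverse (fromRuns ts) ++ reverse (As t)) ++ B ∷ []
    ≡⟨ cong (λ m → (reverse (fromRuns ts) ++ m) ++ B ∷ []) (reverse-As t) ⟩
  (reverse (fromRuns ts) ++ As t) ++ B ∷ [] ∎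

fromRuns-∷ʳ-run : ∀ ts t → fromRuns (ts ++ t ∷ []) ≡ fromRuns ts ++ B ∷ As t
fromRuns-∷ʳ-run ts t =
  trans (fromRuns-++ ts (t ∷ [])) (cong (λ m → fromRuns ts ++ B ∷ m) (LP.++-identityʳ (As t)))

B-reverse-fromRuns : ∀ ts → B ∷ reverse (fromRuns ts) ≡ fromRuns (reverse ts) ++ B ∷ []
B-reverse-fromRuns []       = refl
B-reverse-fromRuns (t ∷ ts) = begin
  B ∷ reverse (fromRuns (t ∷ ts))
    ≡⟨ cong (B ∷_) (reverse-fromRuns-∷ t ts) ⟩
  ((B ∷ reverse (fromRuns ts)) ++ As t) ++ B ∷ []
    ≡⟨ cong (λ m → (m ++ As t) ++ B ∷ []) (B-reverse-fromRuns ts) ⟩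
  ((fromRuns (reverse ts) ++ B ∷ []) ++ As t) ++ B ∷ []
    ≡⟨ cong (_++ B ∷ []) (LP.++-assoc (fromRuns (reverse ts)) (B ∷ []) (As t)) ⟩
  (fromRuns (reverse ts) ++ B ∷ As t) ++ B ∷ []
    ≡⟨ cong (_++ B ∷ []) (sym (fromRuns-∷ʳ-run (reverse ts) t)) ⟩
  fromRuns (reverse ts ++ t ∷ []) ++ B ∷ []
    ≡⟨ cong (λ m → fromRuns m ++ B ∷ []) (sym (LP.unfold-reverse t ts)) ⟩
  fromRuns (reverse (t ∷ ts)) ++ B ∷ [] ∎

coeff-reverse-fromRuns : ∀ t ts w →
  coeff (reverse (fromRuns (t ∷ ts))) w ≡ coeff (fromRuns (reverse ts ++ t ∷ [])) w
coeff-reverse-fromRuns t ts w = begin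
  coeff (reverse (fromRuns (t ∷ ts))) w
    ≡⟨ cong (λ m → coeff m w) (reverse-fromRuns-∷ t ts) ⟩
  coeff ((reverse (fromRuns ts) ++ As t) ++ B ∷ []) w
    ≡⟨ sym (coeff-rotate₁ B (reverse (fromRuns ts) ++ As t) w) ⟩
  coeff ((B ∷ reverse (fromRuns ts)) ++ As t) w
    ≡⟨ cong (λ m → coeff (m ++ As t) w) (B-reverse-fromRuns ts) ⟩
  coeff ((fromRuns (reverse ts) ++ B ∷ []) ++ As t) w
    ≡⟨ cong (λ m → coeff m w) (trans (LP.++-assoc (fromRuns (reverse ts)) (B ∷ []) (As t))
                                     (sym (fromRuns-∷ʳ-run (reverse ts) t))) ⟩
  coeff (fromRuns (reverse ts ++ t ∷ [])) w ∎

∷-as-∷ʳ : ∀ (t : ℕ) ts → Σ (List ℕ) λ rs → Σ ℕ λ r → t ∷ ts ≡ rs ++ r ∷ []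
∷-as-∷ʳ t []        = [] , t , refl
∷-as-∷ʳ t (t' ∷ ts) with ∷-as-∷ʳ t' ts
... | rs , r , e = t ∷ rs , r , cong (t ∷_) e

coeff-reverse-runs : ∀ t ts w → coeff (fromRuns (t ∷ ts)) w ≡ coeff (reverse (fromRuns (t ∷ ts))) w
coeff-reverse-runs t ts w with ∷-as-∷ʳ t ts
... | rs , r , e = begin
  coeff (fromRuns (t ∷ ts)) w                    ≡⟨ cong (λ m → coeff (fromRuns m) w) e ⟩
  coeff (fromRuns (rs ++ r ∷ [])) w              ≡⟨ coeff-fromRuns rs r w ⟩
  monomial (cycRuns (rs ++ r ∷ [])) w            ≡⟨ cong (λ m → monomial (cycRuns m) w) (sym e) ⟩
  monomial (cycRuns (t ∷ ts)) w                  ≡⟨ cong (λ m → monomial m w) (sym (cycRuns-reverse (t ∷ ts))) ⟩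
  monomial (cycRuns (reverse (t ∷ ts))) w        ≡⟨ cong (λ m → monomial (cycRuns m) w) (LP.unfold-reverse t ts) ⟩
  monomial (cycRuns (reverse ts ++ t ∷ [])) w    ≡⟨ sym (coeff-fromRuns (reverse ts) t w) ⟩
  coeff (fromRuns (reverse ts ++ t ∷ [])) w      ≡⟨ sym (coeff-reverse-fromRuns t ts w) ⟩
  coeff (reverse (fromRuns (t ∷ ts))) w          ∎

runDecomposition : ∀ z → All AB z → Σ ℕ λ k → Σ (List ℕ) λ rs → z ≡ As k ++ fromRuns rs
runDecomposition []      []          = 0 , [] , refl
runDecomposition (A ∷ z) (isA ∷ pz) with runDecomposition z pz
... | k , rs , refl = suc k , rs , refl
runDecomposition (B ∷ z) (isB ∷ pz) with runDecomposition z pz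
... | k , rs , refl = 0 , k ∷ rs , refl

noX⇒AB : ∀ W → X ∉ W → All AB W
noX⇒AB []      X∉W = []
noX⇒AB (A ∷ W) X∉W = isA ∷ noX⇒AB W (λ X∈W → X∉W (there X∈W))
noX⇒AB (B ∷ W) X∉W = isB ∷ noX⇒AB W (λ X∈W → X∉W (there X∈W))
noX⇒AB (X ∷ W) X∉W = ⊥-elim (X∉W (here refl))

coeff-reverse-B : ∀ z → All AB z → ∀ w → coeff (B ∷ z) w ≡ coeff (reverse (B ∷ z)) w
coeff-reverse-B z pz w with runDecomposition z pz
... | k , rs , refl = coeff-reverse-runs k rs w

-- Write W = A^k ++ fromRuns rs.  Without runs W is a palindrome; otherwise W
-- is a rotation of a sentence starting with B.
lemma4p6 : (W : List Letter) → X ∉ W → (w : ℕ) → coeff W w ≡ coeff (reverse W) w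
lemma4p6 W X∉W w with runDecomposition W (noX⇒AB W X∉W)
... | k , [] , refl rewrite LP.++-identityʳ (As k) | reverse-As k = refl
... | k , t ∷ ts , refl =
  reversal-rotate (As k) (fromRuns (t ∷ ts)) w
    (coeff-reverse-B _ (All.tail (AllP.++⁺ (fromRuns-AB (t ∷ ts)) (As-AB k))) w)
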